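{- For every integer $m\ge0$, as formal power series in $z,y$, \[ \sum_{n\ge0}\sum_{k\ge0}\mathcal{B}_{n,m}^{(-k)}(a,q,L)\frac{z^n}{n!}\frac{y^k}{k!}=\frac{l^a e^{ay}}{1-\frac{l}{q}(1-e^{ -qz})e^{\frac{ay}{a+m}}}. \]
   Context: Let $a,q,l$ be nonzero reals (with $a+j\neq0$ for integers $j\ge0$; $l^{a+i}$ means $l^al^i$). Let $\left\{ {n \atop i} \right\}$ be the Stirling numbers of the second kind. For integers $k\ge0$, $n,m\ge0$, define \[ \mathcal{B}_{n,m}^{(-k)}(a,q,L)=\frac{a^k}{(a+m)^k}\sum_{i=0}^{n}i!\,(-q)^{n-i}\,l^{i+a}\,(a+m+i)^k\left\{ {n \atop i} \right\}, \] i.e. the generalized $m$-poly-Bernoulli number $\frac{(a+m)^{k'}}{a^{k'}}\sum_{i=0}^{n}\frac{i!(-q)^{n-i}l^{i+a}}{(a+m+i)^{k'}}\left\{ {n \atop i} \right\}$ with $k'=-k$. -}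

module Defs where

open import Level using (Level; _⊔_) renaming (suc to lsuc)
open import Algebra.Bundles using (CommutativeRing)
open import Data.Nat as ℕ using (ℕ; zero; suc; _∸_)
open import Data.Nat.Base using (_!)
open import Relation.Nullary using (¬_)

stirling2 : ℕ → ℕ → ℕ
stirling2 zero    zero    = 1
stirling2 zero    (suc i) = 0
stirling2 (suc n) zero    = 0
stirling2 (suc n) (suc i) = suc i ℕ.* stirling2 n (suc i) ℕ.+ stirling2 n i

module RingOps {c ℓ : Level} (R : CommutativeRing c ℓ) where
  open CommutativeRing R

  fromℕ : ℕ → Carrier
  fromℕ zero    = 0#
  fromℕ (suc n) = 1# + fromℕ n

  pow : Carrier → ℕ → Carrier
  pow x zero    = 1#
  pow x (suc n) = x * pow x n

  sumTo : ℕ → (ℕ → Carrier) → Carrier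
  sumTo zero    f = f 0
  sumTo (suc n) f = sumTo n f + f (suc n)

record CharZeroField (c ℓ : Level) : Set (lsuc (c ⊔ ℓ)) where
  field
    cring : CommutativeRing c ℓ
  open CommutativeRing cring public hiding (ring)
  open RingOps cring public
  field
    _⁻¹        : Carrier → Carrier
    ⁻¹-inverse : ∀ x → ¬ (x ≈ 0#) → (x * (x ⁻¹)) ≈ 1#
    charZero   : ∀ n → ¬ (fromℕ (suc n) ≈ 0#)

module Series {c ℓ : Level} (K : CharZeroField c ℓ) where
  open CharZeroField K

  -- formal power series in two variables z, y: F n k = coefficient of z^n y^k
  PS : Set c
  PS = ℕ → ℕ → Carrier

  constPS : Carrier → PS
  constPS x zero zero = x
  constPS x _    _    = 0#

  onePS : PS
  onePS = constPS 1#

  addPS : PS → PS → PS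
  addPS F G n k = F n k + G n k

  negPS : PS → PS
  negPS F n k = - F n k

  subPS : PS → PS → PS
  subPS F G = addPS F (negPS G)

  scalePS : Carrier → PS → PS
  scalePS x F n k = x * F n k

  mulPS : PS → PS → PS
  mulPS F G n k = sumTo n (λ i → sumTo k (λ j → F i j * G (n ∸ i) (k ∸ j)))

  powPS : PS → ℕ → PS
  powPS F zero    = onePS
  powPS F (suc j) = mulPS F (powPS F j)

  -- 1/(1 - F) for a series F with zero constant term: the geometric series
  -- Σ_j F^j, whose (n,k) coefficient only involves j ≤ n + k.
  geomInv : PS → PS
  geomInv F n k = sumTo (n ℕ.+ k) (λ j → powPS F j n k)

  expZ : Carrier → PS
  expZ x n zero    = pow x n * (fromℕ (n !) ⁻¹)
  expZ x n (suc k) = 0#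

  expY : Carrier → PS
  expY x zero    k = pow x k * (fromℕ (k !) ⁻¹)
  expY x (suc n) k = 0#

  -- Parameters: a, q, l and la standing for l^a (so l^{a+i} = la * l^i).
  -- B_{n,m}^{(-k)}(a,q,L)
  --  = a^k/(a+m)^k Σ_{i=0}^n i! (-q)^{n-i} l^{i+a} (a+m+i)^k {n over i}
  negPolyBernoulli : (a q l la : Carrier) (m n k : ℕ) → Carrier
  negPolyBernoulli a q l la m n k =
    (pow a k * pow ((a + fromℕ m) ⁻¹) k) *
    sumTo n (λ i → fromℕ (i !) * pow (- q) (n ∸ i) * (la * pow l i)
                   * pow (a + fromℕ m + fromℕ i) k * fromℕ (stirling2 n i))

  genLHS : (a q l la : Carrier) (m : ℕ) → PS
  genLHS a q l la m n k =
    negPolyBernoulli a q l la m n k * (fromℕ (n !) ⁻¹) * (fromℕ (k !) ⁻¹)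

  genRHS : (a q l la : Carrier) (m : ℕ) → PS
  genRHS a q l la m =
    scalePS la (mulPS (expY a) (geomInv
      (mulPS (scalePS (l * (q ⁻¹)) (subPS onePS (expZ (- q))))
             (expY (a * ((a + fromℕ m) ⁻¹))))))

-- Put b = a/(a+m) and U(z) = (l/q)(1 − e^{−qz}). The series inverted on the right is U(z) e^{by}, so
-- the right side is l^a Σ_t U(z)^t e^{(a+tb)y}. From U(0) = 0 and U′ = l − qU, differentiating U^t gives
-- the Stirling recurrence, hence n! [z^n] U^t = t! l^t (−q)^{n−t} {n t}, which vanishes for t > n; and
-- a + tb = b(a+m+t) gives k! [y^k] e^{(a+tb)y} = a^k (a+m+t)^k / (a+m)^k. Comparing coefficients yields
-- exactly the finite sum defining the poly-Bernoulli numbers.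
module Submission where

open import Defs
open import Level using (Level)
open import Data.Nat using (ℕ)
open import Relation.Nullary using (¬_)

open import Algebra.Bundles using (CommutativeRing)
import Algebra.Properties.Ring as RingProperties
import Algebra.Solver.Ring.NaturalCoefficients.Default as NatCoeffSolver
import Data.Nat as ℕ
open import Data.Nat using (zero; suc; _∸_; _!; _<_; _≤_; z≤n; s≤s; NonZero; _<?_)
import Data.Nat.Properties as ℕₚ
open import Relation.Binary.PropositionalEquality as ≡ using (_≡_)
import Relation.Binary.Reasoning.Setoid as SetoidReasoning
open import Relation.Nullary using (yes; no)

stirling2-vanishes : ∀ {n i} → n < i → stirling2 n i ≡ 0
stirling2-vanishes {zero}  {suc i} _          = ≡.refl
stirling2-vanishes {suc n} {suc i} (s≤s n<i)
  rewrite stirling2-vanishes (ℕₚ.m≤n⇒m≤1+n n<i) | stirling2-vanishes n<i =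
  ≡.trans (ℕₚ.+-identityʳ (i ℕ.* 0)) (ℕₚ.*-zeroʳ i)

module PowerSeries {c ℓ : Level} (R : CommutativeRing c ℓ) where
  open CommutativeRing R
  open RingOps R
  open NatCoeffSolver commutativeSemiring using (solve; _:=_; _:+_; _:*_; con)
  open SetoidReasoning setoid

  fromℕ-+ : ∀ m n → fromℕ (m ℕ.+ n) ≈ fromℕ m + fromℕ n
  fromℕ-+ zero    n = sym (+-identityˡ _)
  fromℕ-+ (suc m) n = trans (+-congˡ (fromℕ-+ m n)) (sym (+-assoc _ _ _))

  fromℕ-* : ∀ m n → fromℕ (m ℕ.* n) ≈ fromℕ m * fromℕ n
  fromℕ-* zero    n = sym (zeroˡ _)
  fromℕ-* (suc m) n = begin
    fromℕ (n ℕ.+ m ℕ.* n)            ≈⟨ fromℕ-+ n (m ℕ.* n) ⟩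
    fromℕ n + fromℕ (m ℕ.* n)        ≈⟨ +-cong (sym (*-identityˡ _)) (fromℕ-* m n) ⟩
    1# * fromℕ n + fromℕ m * fromℕ n ≈⟨ distribʳ _ _ _ ⟨
    (1# + fromℕ m) * fromℕ n         ∎

  fromℕ-1 : fromℕ 1 ≈ 1#
  fromℕ-1 = +-identityʳ 1#

  pow-cong : ∀ {x y} n → x ≈ y → pow x n ≈ pow y n
  pow-cong zero    x≈y = refl
  pow-cong (suc n) x≈y = *-cong x≈y (pow-cong n x≈y)

  pow-* : ∀ x y n → pow (x * y) n ≈ pow x n * pow y n
  pow-* x y zero    = sym (*-identityˡ 1#)
  pow-* x y (suc n) = trans (*-congˡ (pow-* x y n))
    (solve 4 (λ x y u v → (x :* y) :* (u :* v) := (x :* u) :* (y :* v)) refl _ _ _ _)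

  sumTo-cong : ∀ n {f g : ℕ → Carrier} → (∀ i → f i ≈ g i) → sumTo n f ≈ sumTo n g
  sumTo-cong zero    f≈g = f≈g 0
  sumTo-cong (suc n) f≈g = +-cong (sumTo-cong n f≈g) (f≈g (suc n))

  sumTo-cong≤ : ∀ n {f g : ℕ → Carrier} → (∀ i → i ≤ n → f i ≈ g i) → sumTo n f ≈ sumTo n g
  sumTo-cong≤ zero    f≈g = f≈g 0 z≤n
  sumTo-cong≤ (suc n) f≈g =
    +-cong (sumTo-cong≤ n (λ i i≤n → f≈g i (ℕₚ.m≤n⇒m≤1+n i≤n))) (f≈g (suc n) ℕₚ.≤-refl)

  sumTo-+ : ∀ n (f g : ℕ → Carrier) → sumTo n (λ i → f i + g i) ≈ sumTo n f + sumTo n g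
  sumTo-+ zero    f g = refl
  sumTo-+ (suc n) f g = trans (+-congʳ (sumTo-+ n f g))
    (solve 4 (λ a b x y → (a :+ b) :+ (x :+ y) := (a :+ x) :+ (b :+ y)) refl _ _ _ _)

  sumTo-*ˡ : ∀ n x (f : ℕ → Carrier) → sumTo n (λ i → x * f i) ≈ x * sumTo n f
  sumTo-*ˡ zero    x f = refl
  sumTo-*ˡ (suc n) x f = trans (+-congʳ (sumTo-*ˡ n x f)) (sym (distribˡ _ _ _))

  sumTo-*ʳ : ∀ n x (f : ℕ → Carrier) → sumTo n (λ i → f i * x) ≈ sumTo n f * x
  sumTo-*ʳ zero    x f = refl
  sumTo-*ʳ (suc n) x f = trans (+-congʳ (sumTo-*ʳ n x f)) (sym (distribʳ _ _ _))

  sumTo-zero : ∀ n {f : ℕ → Carrier} → (∀ i → f i ≈ 0#) → sumTo n f ≈ 0#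
  sumTo-zero zero    f≈0 = f≈0 0
  sumTo-zero (suc n) f≈0 = trans (+-cong (sumTo-zero n f≈0) (f≈0 (suc n))) (+-identityˡ 0#)

  sumTo-head : ∀ n (f : ℕ → Carrier) → (∀ i → f (suc i) ≈ 0#) → sumTo n f ≈ f 0
  sumTo-head zero    f tail≈0 = refl
  sumTo-head (suc n) f tail≈0 = trans (+-cong (sumTo-head n f tail≈0) (tail≈0 n)) (+-identityʳ _)

  sumTo-last : ∀ n (f : ℕ → Carrier) → (∀ i → i < n → f i ≈ 0#) → sumTo n f ≈ f n
  sumTo-last zero    f init≈0 = refl
  sumTo-last (suc n) f init≈0 = trans (+-congʳ init-sum≈0) (+-identityˡ _)
    where
    init-sum≈0 : sumTo n f ≈ 0#
    init-sum≈0 = trans (sumTo-cong≤ n (λ i i≤n → init≈0 i (s≤s i≤n))) (sumTo-zero n (λ _ → refl))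

  sumTo-suc : ∀ n (f : ℕ → Carrier) → sumTo (suc n) f ≈ f 0 + sumTo n (λ i → f (suc i))
  sumTo-suc zero    f = refl
  sumTo-suc (suc n) f = trans (+-congʳ (sumTo-suc n f)) (+-assoc _ _ _)

  sumTo-swap : ∀ n k (f : ℕ → ℕ → Carrier) →
    sumTo n (λ i → sumTo k (f i)) ≈ sumTo k (λ j → sumTo n (λ i → f i j))
  sumTo-swap zero    k f = refl
  sumTo-swap (suc n) k f =
    trans (+-congʳ (sumTo-swap n k f)) (sym (sumTo-+ k (λ j → sumTo n (λ i → f i j)) (f (suc n))))

  sumTo-truncate : ∀ n d (f : ℕ → Carrier) → (∀ i → n < i → f i ≈ 0#) → sumTo (n ℕ.+ d) f ≈ sumTo n f
  sumTo-truncate n zero    f tail≈0 = reflexive (≡.cong (λ m → sumTo m f) (ℕₚ.+-identityʳ n))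
  sumTo-truncate n (suc d) f tail≈0 = begin
    sumTo (n ℕ.+ suc d) f                 ≡⟨ ≡.cong (λ m → sumTo m f) (ℕₚ.+-suc n d) ⟩
    sumTo (n ℕ.+ d) f + f (suc (n ℕ.+ d)) ≈⟨ +-cong (sumTo-truncate n d f tail≈0)
                                                     (tail≈0 _ (s≤s (ℕₚ.m≤m+n n d))) ⟩
    sumTo n f + 0#                        ≈⟨ +-identityʳ _ ⟩
    sumTo n f                             ∎

  Seq : Set c
  Seq = ℕ → Carrier

  infixl 7 _⋆_
  _⋆_ : Seq → Seq → Seq
  (f ⋆ g) n = sumTo n (λ i → f i * g (n ∸ i))

  δ : Seq
  δ zero    = 1#
  δ (suc _) = 0#

  infixr 8 _⋆^_
  _⋆^_ : Seq → ℕ → Seq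
  f ⋆^ zero  = δ
  f ⋆^ suc t = f ⋆ f ⋆^ t

  ∂ : Seq → Seq
  ∂ f n = fromℕ (suc n) * f (suc n)

  ⋆-cong : ∀ {f f′ g g′ : Seq} → (∀ i → f i ≈ f′ i) → (∀ i → g i ≈ g′ i) →
           ∀ n → (f ⋆ g) n ≈ (f′ ⋆ g′) n
  ⋆-cong f≈f′ g≈g′ n = sumTo-cong n (λ i → *-cong (f≈f′ i) (g≈g′ (n ∸ i)))

  ⋆-*ˡ : ∀ x (f g : Seq) n → ((λ i → x * f i) ⋆ g) n ≈ x * (f ⋆ g) n
  ⋆-*ˡ x f g n = trans (sumTo-cong n (λ i → *-assoc _ _ _)) (sumTo-*ˡ n x _)

  ⋆-*ʳ : ∀ x (f g : Seq) n → (f ⋆ (λ i → x * g i)) n ≈ x * (f ⋆ g) n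
  ⋆-*ʳ x f g n = trans
    (sumTo-cong n (λ i → solve 3 (λ a x b → a :* (x :* b) := x :* (a :* b)) refl _ _ _))
    (sumTo-*ˡ n x _)

  ⋆-linearˡ : ∀ x y (f g h : Seq) n →
    ((λ i → x * f i + y * g i) ⋆ h) n ≈ x * (f ⋆ h) n + y * (g ⋆ h) n
  ⋆-linearˡ x y f g h n = begin
    sumTo n (λ i → (x * f i + y * g i) * h (n ∸ i))           ≈⟨ sumTo-cong n (λ i → distribʳ _ _ _) ⟩
    sumTo n (λ i → x * f i * h (n ∸ i) + y * g i * h (n ∸ i)) ≈⟨ sumTo-+ n _ _ ⟩
    ((λ i → x * f i) ⋆ h) n + ((λ i → y * g i) ⋆ h) n        ≈⟨ +-cong (⋆-*ˡ x f h n) (⋆-*ˡ y g h n) ⟩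
    x * (f ⋆ h) n + y * (g ⋆ h) n                             ∎

  ⋆-linearʳ : ∀ x y (f g h : Seq) n →
    (h ⋆ (λ i → x * f i + y * g i)) n ≈ x * (h ⋆ f) n + y * (h ⋆ g) n
  ⋆-linearʳ x y f g h n = begin
    sumTo n (λ i → h i * (x * f (n ∸ i) + y * g (n ∸ i)))         ≈⟨ sumTo-cong n (λ i → distribˡ _ _ _) ⟩
    sumTo n (λ i → h i * (x * f (n ∸ i)) + h i * (y * g (n ∸ i))) ≈⟨ sumTo-+ n _ _ ⟩
    (h ⋆ (λ i → x * f i)) n + (h ⋆ (λ i → y * g i)) n            ≈⟨ +-cong (⋆-*ʳ x h f n) (⋆-*ʳ y h g n) ⟩
    x * (h ⋆ f) n + y * (h ⋆ g) n                                 ∎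

  ⋆-identityˡ : ∀ (g : Seq) n → (δ ⋆ g) n ≈ g n
  ⋆-identityˡ g n = trans (sumTo-head n _ (λ i → zeroˡ _)) (*-identityˡ _)

  suc∸ : ∀ {n i} → i ≤ n → suc n ∸ i ≡ suc (n ∸ i)
  suc∸ = ℕₚ.+-∸-assoc 1

  ⋆-identityʳ : ∀ (f : Seq) n → (f ⋆ δ) n ≈ f n
  ⋆-identityʳ f n = begin
    (f ⋆ δ) n       ≈⟨ sumTo-last n _ off-diagonal≈0 ⟩
    f n * δ (n ∸ n) ≡⟨ ≡.cong (λ j → f n * δ j) (ℕₚ.n∸n≡0 n) ⟩
    f n * 1#        ≈⟨ *-identityʳ _ ⟩
    f n             ∎
    where
    off-diagonal≈0 : ∀ i → i < n → f i * δ (n ∸ i) ≈ 0#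
    off-diagonal≈0 i (s≤s i≤n′) = trans (*-congˡ (reflexive (≡.cong δ (suc∸ i≤n′)))) (zeroʳ _)

  ∂-⋆ : ∀ (f g : Seq) n → ∂ (f ⋆ g) n ≈ (∂ f ⋆ g) n + (f ⋆ ∂ g) n
  ∂-⋆ f g n = begin
    fromℕ (suc n) * sumTo (suc n) (λ i → f i * g (suc n ∸ i))   ≈⟨ sumTo-*ˡ (suc n) _ _ ⟨
    sumTo (suc n) (λ i → fromℕ (suc n) * (f i * g (suc n ∸ i))) ≈⟨ sumTo-cong≤ (suc n) split ⟩
    sumTo (suc n) (λ i → fromℕ i * f i * g (suc n ∸ i) + f i * ∂′ (suc n ∸ i))
                                                                 ≈⟨ sumTo-+ (suc n) _ _ ⟩
    sumTo (suc n) (λ i → fromℕ i * f i * g (suc n ∸ i))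
      + sumTo (suc n) (λ i → f i * ∂′ (suc n ∸ i))             ≈⟨ +-cong left right ⟩
    (∂ f ⋆ g) n + (f ⋆ ∂ g) n                                    ∎
    where
    ∂′ : Seq
    ∂′ j = fromℕ j * g j
    split : ∀ i → i ≤ suc n → fromℕ (suc n) * (f i * g (suc n ∸ i))
                            ≈ fromℕ i * f i * g (suc n ∸ i) + f i * ∂′ (suc n ∸ i)
    split i i≤ = trans
      (*-congʳ (trans (reflexive (≡.cong fromℕ (≡.sym (ℕₚ.m+[n∸m]≡n i≤)))) (fromℕ-+ i (suc n ∸ i))))
      (solve 4 (λ a b x y → (a :+ b) :* (x :* y) := a :* x :* y :+ x :* (b :* y)) refl _ _ _ _)
    left : sumTo (suc n) (λ i → fromℕ i * f i * g (suc n ∸ i)) ≈ (∂ f ⋆ g) n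
    left = trans (sumTo-suc n _) (trans (+-congʳ (trans (*-congʳ (zeroˡ _)) (zeroˡ _))) (+-identityˡ _))
    right : sumTo (suc n) (λ i → f i * ∂′ (suc n ∸ i)) ≈ (f ⋆ ∂ g) n
    right = trans
      (+-cong (sumTo-cong≤ n (λ i i≤ → *-congˡ (reflexive (≡.cong ∂′ (suc∸ i≤)))))
              (trans (*-congˡ (trans (*-congʳ (reflexive (≡.cong fromℕ (ℕₚ.n∸n≡0 n)))) (zeroˡ _)))
                     (zeroʳ _)))
      (+-identityʳ _)

  ∂≈*⇒n!*≈pow : ∀ {P : Seq} x → P 0 ≈ 1# → (∀ n → ∂ P n ≈ x * P n) →
    ∀ n → fromℕ (n !) * P n ≈ pow x n
  ∂≈*⇒n!*≈pow x P0≈1 ∂P≈xP zero = trans (*-cong fromℕ-1 P0≈1) (*-identityˡ 1#)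
  ∂≈*⇒n!*≈pow {P} x P0≈1 ∂P≈xP (suc n) = begin
    fromℕ (suc n ℕ.* n !) * P (suc n)       ≈⟨ *-congʳ (fromℕ-* (suc n) (n !)) ⟩
    fromℕ (suc n) * fromℕ (n !) * P (suc n) ≈⟨ solve 3 (λ a b p → a :* b :* p := b :* (a :* p)) refl _ _ _ ⟩
    fromℕ (n !) * ∂ P n                     ≈⟨ *-congˡ (∂P≈xP n) ⟩
    fromℕ (n !) * (x * P n)                 ≈⟨ solve 3 (λ f x p → f :* (x :* p) := x :* (f :* p)) refl _ _ _ ⟩
    x * (fromℕ (n !) * P n)                 ≈⟨ *-congˡ (∂≈*⇒n!*≈pow x P0≈1 ∂P≈xP n) ⟩
    x * pow x n                             ∎

  stirlingTerm : Carrier → Carrier → ℕ → ℕ → Carrier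
  stirlingTerm l r t n = fromℕ (t !) * pow l t * pow r (n ∸ t) * fromℕ (stirling2 n t)

  -- When n ≤ t the Stirling factor vanishes, so the truncated subtraction does no harm.
  pow-∸-stirling2 : ∀ x n t → pow x (n ∸ t) * fromℕ (stirling2 n (suc t))
                            ≈ x * pow x (n ∸ suc t) * fromℕ (stirling2 n (suc t))
  pow-∸-stirling2 x n t with t <? n
  ... | yes t<n = *-congʳ (reflexive (≡.cong (pow x) (ℕₚ.+-∸-assoc 1 t<n)))
  ... | no  t≮n = trans (*-congˡ S≈0) (trans (zeroʳ _) (sym (trans (*-congˡ S≈0) (zeroʳ _))))
    where
    S≈0 : fromℕ (stirling2 n (suc t)) ≈ 0#
    S≈0 = reflexive (≡.cong fromℕ (stirling2-vanishes (s≤s (ℕₚ.≮⇒≥ t≮n))))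

  stirlingTerm-suc : ∀ l r t n → stirlingTerm l r (suc t) (suc n)
                   ≈ fromℕ (suc t) * (l * stirlingTerm l r t n + r * stirlingTerm l r (suc t) n)
  stirlingTerm-suc l r t n = begin
    fromℕ (suc t ℕ.* t !) * (l * L) * W * fromℕ (suc t ℕ.* A ℕ.+ B)
      ≈⟨ *-cong (*-congʳ (*-congʳ (fromℕ-* (suc t) (t !))))
                (trans (fromℕ-+ (suc t ℕ.* A) B) (+-congʳ (fromℕ-* (suc t) A))) ⟩
    s * Ft * (l * L) * W * (s * fromℕ A + fromℕ B)
      ≈⟨ solve 7 (λ s Ft l L W A B → s :* Ft :* (l :* L) :* W :* (s :* A :+ B)
                   := s :* Ft :* l :* L :* s :* (W :* A) :+ s :* Ft :* l :* L :* W :* B)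
               refl s Ft l L W (fromℕ A) (fromℕ B) ⟩
    s * Ft * l * L * s * (W * fromℕ A) + s * Ft * l * L * W * fromℕ B
      ≈⟨ +-congʳ (*-congˡ (pow-∸-stirling2 r n t)) ⟩
    s * Ft * l * L * s * (r * W′ * fromℕ A) + s * Ft * l * L * W * fromℕ B
      ≈⟨ solve 9 (λ s Ft l L W W′ A B r →
                   s :* Ft :* l :* L :* s :* (r :* W′ :* A) :+ s :* Ft :* l :* L :* W :* B
                   := s :* (l :* (Ft :* L :* W :* B) :+ r :* (s :* Ft :* (l :* L) :* W′ :* A)))
               refl s Ft l L W W′ (fromℕ A) (fromℕ B) r ⟩
    s * (l * stirlingTerm l r t n + r * (s * Ft * (l * L) * W′ * fromℕ A))
      ≈⟨ *-congˡ (+-congˡ (*-congˡ (*-congʳ (*-congʳ (*-congʳ (sym (fromℕ-* (suc t) (t !)))))))) ⟩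
    s * (l * stirlingTerm l r t n + r * stirlingTerm l r (suc t) n) ∎
    where
    s  = fromℕ (suc t)
    Ft = fromℕ (t !)
    L  = pow l t
    W  = pow r (n ∸ t)
    W′ = pow r (n ∸ suc t)
    A  = stirling2 n (suc t)
    B  = stirling2 n t

  -- These hypotheses say U = (l/r)(e^{rz} − 1).
  module _ {U : Seq} {l r : Carrier} (U0≈0 : U 0 ≈ 0#) (∂U≈lδ+rU : ∀ n → ∂ U n ≈ l * δ n + r * U n) where

    ∂-⋆^-suc : ∀ t n → ∂ (U ⋆^ suc t) n ≈ fromℕ (suc t) * (l * (U ⋆^ t) n + r * (U ⋆^ suc t) n)
    ∂-⋆^-suc zero n = begin
      ∂ (U ⋆ δ) n                           ≈⟨ ∂-⋆ U δ n ⟩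
      (∂ U ⋆ δ) n + (U ⋆ ∂ δ) n             ≈⟨ +-cong (⋆-identityʳ (∂ U) n)
                                                      (sumTo-zero n (λ i → trans (*-congˡ (zeroʳ _)) (zeroʳ _))) ⟩
      ∂ U n + 0#                            ≈⟨ +-identityʳ _ ⟩
      ∂ U n                                 ≈⟨ ∂U≈lδ+rU n ⟩
      l * δ n + r * U n                     ≈⟨ +-congˡ (*-congˡ (⋆-identityʳ U n)) ⟨
      l * δ n + r * (U ⋆ δ) n               ≈⟨ trans (*-congʳ fromℕ-1) (*-identityˡ _) ⟨
      fromℕ 1 * (l * δ n + r * (U ⋆ δ) n)   ∎
    ∂-⋆^-suc (suc t) n = begin
      ∂ (U ⋆ P) n
        ≈⟨ ∂-⋆ U P n ⟩
      (∂ U ⋆ P) n + (U ⋆ ∂ P) n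
        ≈⟨ +-cong (⋆-cong {g = P} {g′ = P} ∂U≈lδ+rU (λ _ → refl) n)
                  (⋆-cong {f = U} {f′ = U} (λ _ → refl) (∂-⋆^-suc t) n) ⟩
      ((λ i → l * δ i + r * U i) ⋆ P) n + (U ⋆ (λ i → s * Q i)) n
        ≈⟨ +-cong (⋆-linearˡ l r δ U P n) (⋆-*ʳ s U Q n) ⟩
      l * (δ ⋆ P) n + r * (U ⋆ P) n + s * (U ⋆ Q) n
        ≈⟨ +-cong (+-congʳ (*-congˡ (⋆-identityˡ P n))) (*-congˡ (⋆-linearʳ l r (U ⋆^ t) P U n)) ⟩
      l * P n + r * (U ⋆ P) n + s * (l * P n + r * (U ⋆ P) n)
        ≈⟨ solve 2 (λ X s → X :+ s :* X := (con 1 :+ s) :* X) refl (l * P n + r * (U ⋆ P) n) s ⟩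
      fromℕ (suc (suc t)) * (l * P n + r * (U ⋆ P) n)   ∎
      where
      P = U ⋆^ suc t
      s = fromℕ (suc t)
      Q : Seq
      Q i = l * (U ⋆^ t) i + r * P i

    ⋆^-stirling : ∀ t n → fromℕ (n !) * (U ⋆^ t) n ≈ stirlingTerm l r t n
    ⋆^-stirling zero    zero    = sym (trans (*-congˡ fromℕ-1) (trans (*-identityʳ _) (*-identityʳ _)))
    ⋆^-stirling (suc t) zero    = trans (*-congˡ (trans (*-congʳ U0≈0) (zeroˡ _))) (trans (zeroʳ _) (sym (zeroʳ _)))
    ⋆^-stirling zero    (suc n) = trans (zeroʳ _) (sym (zeroʳ _))
    ⋆^-stirling (suc t) (suc n) = begin
      fromℕ (suc n ℕ.* n !) * (U ⋆^ suc t) (suc n)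
        ≈⟨ *-congʳ (fromℕ-* (suc n) (n !)) ⟩
      fromℕ (suc n) * fromℕ (n !) * (U ⋆^ suc t) (suc n)
        ≈⟨ solve 3 (λ a b p → a :* b :* p := b :* (a :* p)) refl _ _ _ ⟩
      fromℕ (n !) * ∂ (U ⋆^ suc t) n
        ≈⟨ *-congˡ (∂-⋆^-suc t n) ⟩
      fromℕ (n !) * (s * (l * (U ⋆^ t) n + r * (U ⋆^ suc t) n))
        ≈⟨ solve 6 (λ f s l x r y → f :* (s :* (l :* x :+ r :* y)) := s :* (l :* (f :* x) :+ r :* (f :* y)))
                 refl _ _ _ _ _ _ ⟩
      s * (l * (fromℕ (n !) * (U ⋆^ t) n) + r * (fromℕ (n !) * (U ⋆^ suc t) n))
        ≈⟨ *-congˡ (+-cong (*-congˡ (⋆^-stirling t n)) (*-congˡ (⋆^-stirling (suc t) n))) ⟩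
      s * (l * stirlingTerm l r t n + r * stirlingTerm l r (suc t) n)
        ≈⟨ stirlingTerm-suc l r t n ⟨
      stirlingTerm l r (suc t) (suc n) ∎
      where
      s = fromℕ (suc t)

module CharZero {c ℓ : Level} (K : CharZeroField c ℓ) where
  open CharZeroField K
  open Series K
  open PowerSeries cring
  open RingProperties (CommutativeRing.ring cring) using (-‿distribˡ-*; -‿distribʳ-*)
  open NatCoeffSolver commutativeSemiring using (solve; _:=_; _:+_; _:*_; con)
  open SetoidReasoning setoid

  fromℕ-!≉0 : ∀ n → ¬ fromℕ (n !) ≈ 0#
  fromℕ-!≉0 n = nonZero (n !) {{ℕₚ._!≢0 n}}
    where
    nonZero : ∀ m → .{{NonZero m}} → ¬ fromℕ m ≈ 0#
    nonZero (suc m) = charZero m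

  *≈⇒≈⁻¹* : ∀ {x y z} → ¬ x ≈ 0# → x * y ≈ z → y ≈ x ⁻¹ * z
  *≈⇒≈⁻¹* {x} {y} {z} x≉0 xy≈z = begin
    y                ≈⟨ *-identityˡ y ⟨
    1# * y           ≈⟨ *-congʳ (trans (*-comm _ _) (⁻¹-inverse x x≉0)) ⟨
    x ⁻¹ * x * y     ≈⟨ *-assoc _ _ _ ⟩
    x ⁻¹ * (x * y)   ≈⟨ *-congˡ xy≈z ⟩
    x ⁻¹ * z         ∎

  x≈y*z⇒y*x⁻¹≈z⁻¹ : ∀ {x y z} → ¬ x ≈ 0# → ¬ z ≈ 0# → x ≈ y * z → y * x ⁻¹ ≈ z ⁻¹
  x≈y*z⇒y*x⁻¹≈z⁻¹ {x} {y} {z} x≉0 z≉0 x≈yz = sym (begin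
    z ⁻¹                       ≈⟨ *-identityʳ _ ⟨
    z ⁻¹ * 1#                  ≈⟨ *-congˡ (⁻¹-inverse x x≉0) ⟨
    z ⁻¹ * (x * x ⁻¹)          ≈⟨ *-congˡ (*-congʳ x≈yz) ⟩
    z ⁻¹ * (y * z * x ⁻¹)      ≈⟨ solve 4 (λ z′ y z x′ → z′ :* (y :* z :* x′) := z :* z′ :* (y :* x′))
                                          refl _ _ _ _ ⟩
    z * z ⁻¹ * (y * x ⁻¹)      ≈⟨ *-congʳ (⁻¹-inverse z z≉0) ⟩
    1# * (y * x ⁻¹)            ≈⟨ *-identityˡ _ ⟩
    y * x ⁻¹                   ∎)

  e : Carrier → Seq
  e x n = pow x n * fromℕ (n !) ⁻¹

  e-cong : ∀ {x y} n → x ≈ y → e x n ≈ e y n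
  e-cong n x≈y = *-congʳ (pow-cong n x≈y)

  e-0 : ∀ x → e x 0 ≈ 1#
  e-0 x = begin
    1# * fromℕ 1 ⁻¹       ≈⟨ *-congʳ fromℕ-1 ⟨
    fromℕ 1 * fromℕ 1 ⁻¹  ≈⟨ ⁻¹-inverse (fromℕ 1) (charZero 0) ⟩
    1#                    ∎

  ∂-e : ∀ x n → ∂ (e x) n ≈ x * e x n
  ∂-e x n = begin
    fromℕ (suc n) * (x * pow x n * fromℕ (suc n !) ⁻¹)
      ≈⟨ solve 4 (λ s x p i → s :* (x :* p :* i) := x :* p :* (s :* i)) refl _ _ _ _ ⟩
    x * pow x n * (fromℕ (suc n) * fromℕ (suc n !) ⁻¹)
      ≈⟨ *-congˡ (x≈y*z⇒y*x⁻¹≈z⁻¹ (fromℕ-!≉0 (suc n)) (fromℕ-!≉0 n) (fromℕ-* (suc n) (n !))) ⟩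
    x * pow x n * fromℕ (n !) ⁻¹
      ≈⟨ *-assoc _ _ _ ⟩
    x * e x n ∎

  e-⋆ : ∀ x y n → (e x ⋆ e y) n ≈ e (x + y) n
  e-⋆ x y n = trans (*≈⇒≈⁻¹* (fromℕ-!≉0 n) (∂≈*⇒n!*≈pow (x + y) P0≈1 ∂P≈[x+y]P n)) (*-comm _ _)
    where
    P0≈1 : (e x ⋆ e y) 0 ≈ 1#
    P0≈1 = trans (*-cong (e-0 x) (e-0 y)) (*-identityˡ 1#)
    ∂P≈[x+y]P : ∀ n → ∂ (e x ⋆ e y) n ≈ (x + y) * (e x ⋆ e y) n
    ∂P≈[x+y]P n = begin
      ∂ (e x ⋆ e y) n                                  ≈⟨ ∂-⋆ (e x) (e y) n ⟩
      (∂ (e x) ⋆ e y) n + (e x ⋆ ∂ (e y)) n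
        ≈⟨ +-cong (⋆-cong {g = e y} {g′ = e y} (∂-e x) (λ _ → refl) n)
                  (⋆-cong {f = e x} {f′ = e x} (λ _ → refl) (∂-e y) n) ⟩
      ((λ i → x * e x i) ⋆ e y) n + (e x ⋆ (λ i → y * e y i)) n
                                                       ≈⟨ +-cong (⋆-*ˡ x (e x) (e y) n) (⋆-*ʳ y (e x) (e y) n) ⟩
      x * (e x ⋆ e y) n + y * (e x ⋆ e y) n            ≈⟨ distribʳ _ _ _ ⟨
      (x + y) * (e x ⋆ e y) n                          ∎

  infixr 7 _⊗_
  _⊗_ : Seq → Seq → PS
  (f ⊗ g) n k = f n * g k

  mulPS-cong : ∀ {F F′ G G′ : PS} → (∀ n k → F n k ≈ F′ n k) → (∀ n k → G n k ≈ G′ n k) →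
               ∀ n k → mulPS F G n k ≈ mulPS F′ G′ n k
  mulPS-cong F≈F′ G≈G′ n k =
    sumTo-cong n (λ i → sumTo-cong k (λ j → *-cong (F≈F′ i j) (G≈G′ (n ∸ i) (k ∸ j))))

  mulPS-⊗ : ∀ (f g f′ g′ : Seq) n k → mulPS (f ⊗ g) (f′ ⊗ g′) n k ≈ (f ⋆ f′) n * (g ⋆ g′) k
  mulPS-⊗ f g f′ g′ n k = begin
    sumTo n (λ i → sumTo k (λ j → f i * g j * (f′ (n ∸ i) * g′ (k ∸ j))))
      ≈⟨ sumTo-cong n (λ i → sumTo-cong k (λ j →
           solve 4 (λ a b x y → a :* b :* (x :* y) := a :* x :* (b :* y)) refl _ _ _ _)) ⟩
    sumTo n (λ i → sumTo k (λ j → f i * f′ (n ∸ i) * (g j * g′ (k ∸ j))))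
      ≈⟨ sumTo-cong n (λ i → sumTo-*ˡ k _ _) ⟩
    sumTo n (λ i → f i * f′ (n ∸ i) * (g ⋆ g′) k)
      ≈⟨ sumTo-*ʳ n _ _ ⟩
    (f ⋆ f′) n * (g ⋆ g′) k ∎

  onePS≈δ⊗δ : ∀ n k → onePS n k ≈ (δ ⊗ δ) n k
  onePS≈δ⊗δ zero    zero    = sym (*-identityˡ _)
  onePS≈δ⊗δ zero    (suc k) = sym (zeroʳ _)
  onePS≈δ⊗δ (suc n) k       = sym (zeroˡ _)

  expY≈δ⊗e : ∀ x n k → expY x n k ≈ (δ ⊗ e x) n k
  expY≈δ⊗e x zero    k = sym (*-identityˡ _)
  expY≈δ⊗e x (suc n) k = sym (zeroˡ _)

  module _ {F : PS} {f : Seq} {x : Carrier} (F≈f⊗ex : ∀ n k → F n k ≈ (f ⊗ e x) n k) where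

    powPS-⊗ : ∀ t n k → powPS F t n k ≈ (f ⋆^ t ⊗ e (fromℕ t * x)) n k
    powPS-⊗ zero n k = trans (onePS≈δ⊗δ n k) (*-congˡ (sym (e-zero k)))
      where
      e-zero : ∀ k → e (0# * x) k ≈ δ k
      e-zero zero    = e-0 (0# * x)
      e-zero (suc k) = trans (*-congʳ (trans (*-congʳ (zeroˡ x)) (zeroˡ _))) (zeroˡ _)
    powPS-⊗ (suc t) n k = begin
      mulPS F (powPS F t) n k                     ≈⟨ mulPS-cong F≈f⊗ex (powPS-⊗ t) n k ⟩
      mulPS (f ⊗ e x) (f ⋆^ t ⊗ e tx) n k         ≈⟨ mulPS-⊗ f (e x) (f ⋆^ t) (e tx) n k ⟩
      (f ⋆^ suc t) n * (e x ⋆ e tx) k             ≈⟨ *-congˡ (e-⋆ x tx k) ⟩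
      (f ⋆^ suc t) n * e (x + tx) k               ≈⟨ *-congˡ (e-cong k x+tx≈[1+t]x) ⟩
      (f ⋆^ suc t) n * e (fromℕ (suc t) * x) k    ∎
      where
      tx = fromℕ t * x
      x+tx≈[1+t]x : x + tx ≈ fromℕ (suc t) * x
      x+tx≈[1+t]x = sym (trans (distribʳ _ _ _) (+-congʳ (*-identityˡ x)))

    geomInv-⊗ : (∀ t n → n < t → (f ⋆^ t) n ≈ 0#) →
                ∀ n k → geomInv F n k ≈ sumTo n (λ t → (f ⋆^ t) n * e (fromℕ t * x) k)
    geomInv-⊗ f^t-vanishes n k = trans (sumTo-cong (n ℕ.+ k) (λ t → powPS-⊗ t n k))
      (sumTo-truncate n k _ (λ t n<t → trans (*-congʳ (f^t-vanishes t n n<t)) (zeroˡ _)))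

  mulPS-expY : ∀ x (G : PS) n k → mulPS (expY x) G n k ≈ sumTo k (λ j → e x j * G n (k ∸ j))
  mulPS-expY x G n k = sumTo-head n _ (λ i → sumTo-zero k (λ j → zeroˡ _))

  module PolyBernoulli (a q l la : Carrier) (q≉0 : ¬ q ≈ 0#) (m : ℕ) (a+m≉0 : ¬ (a + fromℕ m) ≈ 0#) where

    c′ : Carrier
    c′ = l * q ⁻¹

    U : Seq
    U n = c′ * δ n + (- c′) * e (- q) n

    U-0 : U 0 ≈ 0#
    U-0 = begin
      c′ * 1# + (- c′) * e (- q) 0    ≈⟨ +-cong (*-identityʳ c′) (trans (*-congˡ (e-0 (- q))) (*-identityʳ _)) ⟩
      c′ + - c′                       ≈⟨ -‿inverseʳ c′ ⟩
      0#                              ∎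

    l+[-q]c′≈0 : l + (- q) * c′ ≈ 0#
    l+[-q]c′≈0 = begin
      l + (- q) * c′      ≈⟨ +-congˡ (-‿distribˡ-* q c′) ⟨
      l + - (q * c′)      ≈⟨ +-congˡ (-‿cong q*c′≈l) ⟩
      l + - l             ≈⟨ -‿inverseʳ l ⟩
      0#                  ∎
      where
      q*c′≈l : q * c′ ≈ l
      q*c′≈l = begin
        q * (l * q ⁻¹)   ≈⟨ solve 3 (λ q l i → q :* (l :* i) := l :* (q :* i)) refl _ _ _ ⟩
        l * (q * q ⁻¹)   ≈⟨ *-congˡ (⁻¹-inverse q q≉0) ⟩
        l * 1#           ≈⟨ *-identityʳ l ⟩
        l                ∎

    ∂U≈lδ-qU : ∀ n → ∂ U n ≈ l * δ n + (- q) * U n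
    ∂U≈lδ-qU n = begin
      fromℕ (suc n) * (c′ * 0# + (- c′) * E (suc n))
        ≈⟨ solve 4 (λ s c d x → s :* (c :* con 0 :+ d :* x) := d :* (s :* x)) refl _ c′ (- c′) _ ⟩
      (- c′) * ∂ E n                                 ≈⟨ *-congˡ (∂-e (- q) n) ⟩
      (- c′) * ((- q) * E n)                         ≈⟨ +-identityˡ _ ⟨
      0# + (- c′) * ((- q) * E n)                    ≈⟨ +-congʳ (trans (*-congʳ l+[-q]c′≈0) (zeroˡ _)) ⟨
      (l + (- q) * c′) * δ n + (- c′) * ((- q) * E n)
        ≈⟨ solve 6 (λ l r c d x y → (l :+ r :* c) :* x :+ d :* (r :* y) := l :* x :+ r :* (c :* x :+ d :* y))
                 refl l (- q) c′ (- c′) (δ n) (E n) ⟩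
      l * δ n + (- q) * U n                          ∎
      where
      E = e (- q)

    U⋆^≈ : ∀ t n → (U ⋆^ t) n ≈ fromℕ (n !) ⁻¹ * stirlingTerm l (- q) t n
    U⋆^≈ t n = *≈⇒≈⁻¹* (fromℕ-!≉0 n) (⋆^-stirling U-0 ∂U≈lδ-qU t n)

    U⋆^-vanishes : ∀ t n → n < t → (U ⋆^ t) n ≈ 0#
    U⋆^-vanishes t n n<t = trans (U⋆^≈ t n) (trans (*-congˡ (trans (*-congˡ S≈0) (zeroʳ _))) (zeroʳ _))
      where
      S≈0 : fromℕ (stirling2 n t) ≈ 0#
      S≈0 = reflexive (≡.cong fromℕ (stirling2-vanishes n<t))

    w : Carrier
    w = (a + fromℕ m) ⁻¹

    b : Carrier
    b = a * w

    F : PS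
    F = mulPS (scalePS c′ (subPS onePS (expZ (- q)))) (expY b)

    F≈U⊗eb : ∀ n k → F n k ≈ (U ⊗ e b) n k
    F≈U⊗eb n k = begin
      F n k                                ≈⟨ mulPS-cong U⊗δ (expY≈δ⊗e b) n k ⟩
      mulPS (U ⊗ δ) (δ ⊗ e b) n k          ≈⟨ mulPS-⊗ U δ δ (e b) n k ⟩
      (U ⋆ δ) n * (δ ⋆ e b) k              ≈⟨ *-cong (⋆-identityʳ U n) (⋆-identityˡ (e b) k) ⟩
      U n * e b k                          ∎
      where
      c[x-y]≈cx+[-c]y : ∀ x y → c′ * (x - y) ≈ c′ * x + (- c′) * y
      c[x-y]≈cx+[-c]y x y =
        trans (distribˡ _ _ _) (+-congˡ (trans (sym (-‿distribʳ-* c′ y)) (-‿distribˡ-* c′ y)))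
      U⊗δ : ∀ n k → scalePS c′ (subPS onePS (expZ (- q))) n k ≈ (U ⊗ δ) n k
      U⊗δ zero    zero    = trans (c[x-y]≈cx+[-c]y _ _) (sym (*-identityʳ _))
      U⊗δ (suc n) zero    = trans (c[x-y]≈cx+[-c]y _ _) (sym (*-identityʳ _))
      U⊗δ zero    (suc k) = trans (*-congˡ (-‿inverseʳ 0#)) (trans (zeroʳ _) (sym (zeroʳ _)))
      U⊗δ (suc n) (suc k) = trans (*-congˡ (-‿inverseʳ 0#)) (trans (zeroʳ _) (sym (zeroʳ _)))

    a+tb≈b[a+m+t] : ∀ t → a + fromℕ t * b ≈ b * (a + fromℕ m + fromℕ t)
    a+tb≈b[a+m+t] t = sym (begin
      a * w * (a + fromℕ m + fromℕ t)
        ≈⟨ solve 4 (λ a w M T → a :* w :* (a :+ M :+ T) := a :* ((a :+ M) :* w) :+ T :* (a :* w))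
                 refl a w (fromℕ m) (fromℕ t) ⟩
      a * ((a + fromℕ m) * w) + fromℕ t * b
        ≈⟨ +-congʳ (trans (*-congˡ (⁻¹-inverse _ a+m≉0)) (*-identityʳ a)) ⟩
      a + fromℕ t * b ∎)

    coefficient : ℕ → ℕ → Carrier
    coefficient n k = la * sumTo n (λ t → (U ⋆^ t) n * e (a + fromℕ t * b) k)

    genRHS≈coefficient : ∀ n k → genRHS a q l la m n k ≈ coefficient n k
    genRHS≈coefficient n k = *-congˡ (begin
      mulPS (expY a) (geomInv F) n k
        ≈⟨ mulPS-expY a (geomInv F) n k ⟩
      sumTo k (λ j → e a j * geomInv F n (k ∸ j))
        ≈⟨ sumTo-cong k (λ j → *-congˡ (geomInv-⊗ F≈U⊗eb U⋆^-vanishes n (k ∸ j))) ⟩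
      sumTo k (λ j → e a j * sumTo n (λ t → (U ⋆^ t) n * e (fromℕ t * b) (k ∸ j)))
        ≈⟨ sumTo-cong k (λ j → sym (sumTo-*ˡ n _ _)) ⟩
      sumTo k (λ j → sumTo n (λ t → e a j * ((U ⋆^ t) n * e (fromℕ t * b) (k ∸ j))))
        ≈⟨ sumTo-swap n k _ ⟨
      sumTo n (λ t → sumTo k (λ j → e a j * ((U ⋆^ t) n * e (fromℕ t * b) (k ∸ j))))
        ≈⟨ sumTo-cong n (λ t → trans (sumTo-cong k (λ j →
             solve 3 (λ x u y → x :* (u :* y) := u :* (x :* y)) refl _ _ _)) (sumTo-*ˡ k _ _)) ⟩
      sumTo n (λ t → (U ⋆^ t) n * (e a ⋆ e (fromℕ t * b)) k)
        ≈⟨ sumTo-cong n (λ t → *-congˡ (e-⋆ a _ k)) ⟩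
      sumTo n (λ t → (U ⋆^ t) n * e (a + fromℕ t * b) k) ∎)

    genLHS≈coefficient : ∀ n k → genLHS a q l la m n k ≈ coefficient n k
    genLHS≈coefficient n k = begin
      pow a k * pow w k * sumTo n X * N * Kf
        ≈⟨ solve 5 (λ A W S N K → A :* W :* S :* N :* K := S :* (A :* W :* N :* K)) refl _ _ _ _ _ ⟩
      sumTo n X * (pow a k * pow w k * N * Kf)
        ≈⟨ sumTo-*ʳ n _ _ ⟨
      sumTo n (λ t → X t * (pow a k * pow w k * N * Kf))
        ≈⟨ sumTo-cong n term ⟩
      sumTo n (λ t → la * ((U ⋆^ t) n * e (a + fromℕ t * b) k))
        ≈⟨ sumTo-*ˡ n la _ ⟩
      coefficient n k ∎
      where
      N = fromℕ (n !) ⁻¹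
      Kf = fromℕ (k !) ⁻¹
      X : ℕ → Carrier
      X t = fromℕ (t !) * pow (- q) (n ∸ t) * (la * pow l t) * pow (a + fromℕ m + fromℕ t) k
            * fromℕ (stirling2 n t)
      term : ∀ t → X t * (pow a k * pow w k * N * Kf) ≈ la * ((U ⋆^ t) n * e (a + fromℕ t * b) k)
      term t = sym (begin
        la * ((U ⋆^ t) n * (pow (a + fromℕ t * b) k * Kf))
          ≈⟨ *-congˡ (*-cong (U⋆^≈ t n) (*-congʳ pow-a+tb)) ⟩
        la * (N * (Ft * L * W * St) * (pow a k * pow w k * Z * Kf))
          ≈⟨ solve 10 (λ la N Ft L W St A V Z Kf →
               la :* (N :* (Ft :* L :* W :* St) :* (A :* V :* Z :* Kf))
               := Ft :* W :* (la :* L) :* Z :* St :* (A :* V :* N :* Kf))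
             refl la N Ft L W St (pow a k) (pow w k) Z Kf ⟩
        X t * (pow a k * pow w k * N * Kf) ∎)
        where
        Ft = fromℕ (t !)
        L  = pow l t
        W  = pow (- q) (n ∸ t)
        St = fromℕ (stirling2 n t)
        Z  = pow (a + fromℕ m + fromℕ t) k
        pow-a+tb : pow (a + fromℕ t * b) k ≈ pow a k * pow w k * Z
        pow-a+tb = trans (pow-cong k (a+tb≈b[a+m+t] t)) (trans (pow-* b _ k) (*-congʳ (pow-* a w k)))

theorem8 : {c ℓ : Level} (K : CharZeroField c ℓ) →
    (a q l la : CharZeroField.Carrier K) →
    ¬ (CharZeroField._≈_ K a (CharZeroField.0# K)) →
    ¬ (CharZeroField._≈_ K q (CharZeroField.0# K)) →
    ¬ (CharZeroField._≈_ K l (CharZeroField.0# K)) →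
    ((j : ℕ) → ¬ (CharZeroField._≈_ K (CharZeroField._+_ K a (CharZeroField.fromℕ K j)) (CharZeroField.0# K))) →
    (m n k : ℕ) →
    CharZeroField._≈_ K (Series.genLHS K a q l la m n k) (Series.genRHS K a q l la m n k)
theorem8 K a q l la _ q≉0 _ a+j≉0 m n k =
  trans (genLHS≈coefficient n k) (sym (genRHS≈coefficient n k))
  where
  open CharZeroField K using (trans; sym)
  open CharZero.PolyBernoulli K a q l la q≉0 m (a+j≉0 m)
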